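{- Let $x=(v_1,\dots,v_{n_d})$, $p\in\mathbb N$, $k\in[n_d]$, $w\in V_r$, and let $S^-_k\subseteq\{k+1,\dots,n_d\}$ and $S^+_k\subseteq\{1,\dots,k\}$. Then the encoded state $(S^-_k,S^+_k,w)$ is an $\mathcal N_{BS-R}$-valid metastate at stage $k$ if and only if (1) $|S^-_k|=|S^+_k|\le \frac p2$; (2) $S^-_k\subseteq\{k+1,\dots,k+p-1\}$ and $S^+_k\subseteq\{k-p+2,\dots,k\}$; (3) $\max\{l:l\in S^-_k\}-\min\{h:h\in S^+_k\}<p$.
   Context: Let $V_d=\{v_1,\dots,v_{n_d}\}$ be the destinations, $V_r$ the replenishment locations, $x=(v_1,\dots,v_{n_d})$, $p\in\mathbb N$, $[n]=\{1,\dots,n\}$. For a permutation $\sigma$ of $[n_d]$ ($\sigma(i)$ = new position of $v_i$), $(v_{\sigma^{ -1}(1)},\dots,v_{\sigma^{ -1}(n_d)})\in\mathcal N_{BS}(x,p)$ iff $\sigma(i)<\sigma(j)$ for all $i,j$ with $i+p\le j$. A metastate at stage $k$ is a pair $(S,w)$ with $S\subseteq V_d$, $|S|=k$, $w\in V_r$; it is $\mathcal N_{BS-R}$-valid iff there is a sequence in $\mathcal N_{BS}(x,p)$ whose first $k$ entries form exactly the set $S$ (the RL $w$ being arbitrary). A set $S\subseteq V_d$ is encoded at stage $k$ by $S^-_k=\{l\ge k+1: v_l\in S\}$ and $S^+_k=\{h\le k: v_h\notin S\}$, so $S=\{v_j: j\in([k]\setminus S^+_k)\cup S^-_k\}$;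 the encoded state $(S^-_k,S^+_k,w)$ stands for the metastate $(S,w)$ at stage $k$ with this $S$ (it is a metastate at stage $k$ only if this $S$ has $k$ elements). Conventions: $\max\emptyset$ and $\min\emptyset$ make condition (3) vacuous when the sets are empty. -}

module Defs where

open import Data.Nat using (ℕ; suc; _+_; _*_; _∸_; _≤_; _<_)
open import Data.Fin using (Fin; toℕ)
open import Data.Fin.Subset using (Subset; _∈_; _∉_; ∣_∣)
open import Data.Fin.Permutation using (Permutation′; _⟨$⟩ʳ_)
open import Data.Product using (Σ; _×_)
open import Data.Sum using (_⊎_)
open import Relation.Binary.PropositionalEquality using (_≡_)

-- Destinations v_1..v_n are indexed by i : Fin n; i stands for v_(pos i).
pos : {n : ℕ} → Fin n → ℕ
pos i = suc (toℕ i)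

-- σ : Permutation′ n, σ(i) = new position of v_i (1-based: pos (σ ⟨$⟩ʳ i)).
-- The sequence (v_σ⁻¹(1), ..., v_σ⁻¹(n)) is in N_BS(x,p) iff
-- σ(i) < σ(j) whenever i + p ≤ j.
InNBS : (n p : ℕ) → Permutation′ n → Set
InNBS n p σ = ∀ (i j : Fin n) → pos i + p ≤ pos j → pos (σ ⟨$⟩ʳ i) < pos (σ ⟨$⟩ʳ j)

InFirst : {n : ℕ} → Permutation′ n → ℕ → Fin n → Set
InFirst σ k i = pos (σ ⟨$⟩ʳ i) ≤ k

Decoded : {n : ℕ} → ℕ → Subset n → Subset n → Fin n → Set
Decoded k Sm Sp i = (pos i ≤ k × i ∉ Sp) ⊎ i ∈ Sm

-- The metastate (S, w) at stage k is N_BS-R-valid iff some sequence in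
-- N_BS(x,p) has its first k entries forming exactly the set S
-- (the replenishment location w is arbitrary, i.e. plays no role).
ValidMetastate : (n p : ℕ) {Vr : Set} → ℕ → (Fin n → Set) → Vr → Set
ValidMetastate n p k S w =
  Σ (Permutation′ n) λ σ → InNBS n p σ ×
    (∀ (i : Fin n) → (S i → InFirst σ k i) × (InFirst σ k i → S i))

ValidEncoded : (n p : ℕ) {Vr : Set} → ℕ → Subset n → Subset n → Vr → Set
ValidEncoded n p k Sm Sp w = ValidMetastate n p k (Decoded k Sm Sp) w

-- Condition (1): |S⁻_k| = |S⁺_k| ≤ p/2   (written 2·|S⁻_k| ≤ p).
Cond1 : {n : ℕ} → ℕ → Subset n → Subset n → Set
Cond1 p Sm Sp = ∣ Sm ∣ ≡ ∣ Sp ∣ × 2 * ∣ Sm ∣ ≤ p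

-- Condition (2): S⁻_k ⊆ {k+1,…,k+p−1} and S⁺_k ⊆ {k−p+2,…,k}.
-- (Given the standing hypotheses S⁻_k ⊆ {k+1,…}, S⁺_k ⊆ {…,k}, only the
-- outer bounds are new; k−p+2 ≤ h is written over ℕ as k+2 ≤ h+p.)
Cond2 : {n : ℕ} → ℕ → ℕ → Subset n → Subset n → Set
Cond2 {n} p k Sm Sp =
  (∀ (l : Fin n) → l ∈ Sm → k < pos l × pos l ≤ k + p ∸ 1) ×
  (∀ (h : Fin n) → h ∈ Sp → k + 2 ≤ pos h + p × pos h ≤ k)

-- Condition (3): max S⁻_k − min S⁺_k < p, vacuous if either set is empty;
-- written out as: for all l ∈ S⁻_k and h ∈ S⁺_k, l − h < p (i.e. l < h + p).
Cond3 : {n : ℕ} → ℕ → Subset n → Subset n → Set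
Cond3 {n} p Sm Sp = ∀ (l h : Fin n) → l ∈ Sm → h ∈ Sp → pos l < pos h + p

-- A set S of destinations consists of the first k entries of some sequence in N_BS(x,p)
-- iff |S| = k and S is closed under going p steps back: v_j ∈ S and i + p ≤ j force v_i ∈ S.
-- Necessity: σ(i) < σ(j) ≤ k.  Sufficiency: list S in increasing order of index, followed by
-- its complement in increasing order; the only pairs whose order this reverses are i ∉ S, j ∈ S
-- with i < j, and closure keeps those within distance p.  For the decoded S,
-- |S| + |S⁺| = k + |S⁻|, so |S| = k is condition |S⁻| = |S⁺|, and closure gives (3).
-- Conversely (2) and (3) give closure, and once |S⁻| = |S⁺|, (3) implies (2) and 2|S⁻| ≤ p:
-- S⁺, S⁻ and the indices below min S⁺ are disjoint and all lie within p of min S⁺.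

module Submission where

open import Defs
open import Data.Nat using (ℕ; zero; suc; _+_; _*_; _∸_; _≤_; _<_; z≤n; s≤s; s≤s⁻¹; _⊓_)
open import Data.Nat.Properties hiding (_≟_)
open import Algebra.Properties.CommutativeSemigroup +-commutativeSemigroup using (xy∙z≈xz∙y)
open import Data.Fin as Fin using (Fin; zero; suc; toℕ; fromℕ<; _≟_)
import Data.Fin.Properties as Finₚ
open import Data.Fin.Subset using (Subset; _∈_; _∉_; ∣_∣; _-_; Nonempty)
open import Data.Fin.Subset.Properties using (_∈?_; nonempty?; Empty-unique; ∣⊥∣≡0; x∈p⇒∣p-x∣<∣p∣; drop-there)
open import Data.Fin.Permutation using (Permutation′; _⟨$⟩ʳ_)
open import Data.Vec using ([]; _∷_; there)
open import Data.Bool using (true; false)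
open import Data.Product using (_×_; _,_; proj₁; proj₂; ∃; Σ)
open import Data.Sum using (_⊎_; inj₁; inj₂)
open import Data.Empty using (⊥-elim)
open import Level using (0ℓ)
open import Relation.Nullary using (Dec; yes; no; ¬_; ¬?)
open import Relation.Nullary.Decidable using (_⊎-dec_)
open import Relation.Unary using (Pred; Decidable; _⊆_)
open import Relation.Unary.Properties using (_∪?_; _∩?_; ∁?)
open import Relation.Binary.PropositionalEquality
open import Relation.Binary.Definitions using (tri<; tri≈; tri>)
open import Function.Base using (_∘_)
open import Function.Bundles using (_⇔_; mk⇔; mk↔ₛ′)
open import Function.Definitions using (Injective)
open import Algebra.Properties.CommutativeMonoid.Sum +-0-commutativeMonoid
  using (sum; sum-permute; ∑-distrib-+; sum-cong-≗)

private variable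
  A B : Set
  n : ℕ

indicator : Dec A → ℕ
indicator (yes _) = 1
indicator (no _)  = 0

indicator-yes : (a : Dec A) → A → indicator a ≡ 1
indicator-yes (yes _) _ = refl
indicator-yes (no ¬a) a = ⊥-elim (¬a a)

indicator-mono : (a : Dec A) (b : Dec B) → (A → B) → indicator a ≤ indicator b
indicator-mono (yes a) (yes _) f = ≤-refl
indicator-mono (yes a) (no ¬b) f = ⊥-elim (¬b (f a))
indicator-mono (no _)  _       f = z≤n

indicator-cong : (a : Dec A) (b : Dec B) → (A → B) → (B → A) → indicator a ≡ indicator b
indicator-cong a b f g = ≤-antisym (indicator-mono a b f) (indicator-mono b a g)

indicator-⊎ : (a : Dec A) (b : Dec B) → (A → ¬ B) →
              indicator (a ⊎-dec b) ≡ indicator a + indicator b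
indicator-⊎ (yes a) (yes b) disj = ⊥-elim (disj a b)
indicator-⊎ (yes _) (no _)  _    = refl
indicator-⊎ (no _)  (yes _) _    = refl
indicator-⊎ (no _)  (no _)  _    = refl

indicator-∁ : (a : Dec A) → indicator a + indicator (¬? a) ≡ 1
indicator-∁ (yes _) = refl
indicator-∁ (no _)  = refl

sum-mono : {f g : Fin n → ℕ} → (∀ i → f i ≤ g i) → sum f ≤ sum g
sum-mono {zero}  _   = z≤n
sum-mono {suc n} f≤g = +-mono-≤ (f≤g zero) (sum-mono (f≤g ∘ suc))

term≤sum : (f : Fin n → ℕ) (i : Fin n) → f i ≤ sum f
term≤sum f zero    = m≤m+n _ _
term≤sum f (suc i) = ≤-trans (term≤sum (f ∘ suc) i) (m≤n+m _ _)

count : {P : Pred (Fin n) 0ℓ} → Decidable P → ℕ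
count P? = sum (λ i → indicator (P? i))

module _ {P Q : Pred (Fin n) 0ℓ} (P? : Decidable P) (Q? : Decidable Q) where

  count-mono : P ⊆ Q → count P? ≤ count Q?
  count-mono P⊆Q = sum-mono (λ i → indicator-mono (P? i) (Q? i) P⊆Q)

  count-cong : P ⊆ Q → Q ⊆ P → count P? ≡ count Q?
  count-cong P⊆Q Q⊆P = sum-cong-≗ (λ i → indicator-cong (P? i) (Q? i) P⊆Q Q⊆P)

  count-∪ : (∀ {i} → P i → ¬ Q i) → count (P? ∪? Q?) ≡ count P? + count Q?
  count-∪ disjoint = begin
    count (P? ∪? Q?)                                  ≡⟨ sum-cong-≗ (λ i → indicator-⊎ (P? i) (Q? i) disjoint) ⟩
    sum (λ i → indicator (P? i) + indicator (Q? i))  ≡⟨ ∑-distrib-+ (indicator ∘ P?) (indicator ∘ Q?) ⟩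
    count P? + count Q?                               ∎
    where open ≡-Reasoning

count-strict-mono : {P Q : Pred (Fin n) 0ℓ} (P? : Decidable P) (Q? : Decidable Q) →
                    P ⊆ Q → ∀ {i} → ¬ P i → Q i → count P? < count Q?
count-strict-mono {P = P} P? Q? P⊆Q {i} ¬Pi Qi = begin-strict
  count P?                  <⟨ m<m+n (count P?) one≤ ⟩
  count P? + count (_≟ i)   ≡⟨ count-∪ P? (_≟ i) disjoint ⟨
  count (P? ∪? (_≟ i))      ≤⟨ count-mono (P? ∪? (_≟ i)) Q? (λ { (inj₁ Px) → P⊆Q Px ; (inj₂ refl) → Qi }) ⟩
  count Q?                  ∎
  where
  open ≤-Reasoning
  disjoint : ∀ {x} → P x → ¬ x ≡ i
  disjoint Px refl = ¬Pi Px
  one≤ : 0 < count (_≟ i)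
  one≤ = ≤-trans (≤-reflexive (sym (indicator-yes (i ≟ i) refl))) (term≤sum _ i)

count-toℕ< : ∀ n b → count {n} (λ i → toℕ i <? b) ≡ b ⊓ n
count-toℕ< zero    b       = sym (⊓-zeroʳ b)
count-toℕ< (suc n) zero    = trans
  (count-cong (λ (i : Fin n) → suc (toℕ i) <? 0) (λ i → toℕ i <? 0) (λ ()) (λ ()))
  (count-toℕ< n zero)
count-toℕ< (suc n) (suc b) = cong suc (trans
  (count-cong (λ (i : Fin n) → suc (toℕ i) <? suc b) (λ i → toℕ i <? b) ≤-pred s≤s)
  (count-toℕ< n b))

count-below : ∀ {b} → b ≤ n → count {n} (λ i → toℕ i <? b) ≡ b
count-below {n} {b} b≤n = trans (count-toℕ< n b) (m≤n⇒m⊓n≡m b≤n)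

count-∁ : {P : Pred (Fin n) 0ℓ} (P? : Decidable P) → count P? + count (∁? P?) ≡ n
count-∁ {n} P? = begin
  count P? + count (∁? P?)                   ≡⟨ ∑-distrib-+ (indicator ∘ P?) (indicator ∘ ∁? P?) ⟨
  sum (λ i → indicator (P? i) + indicator (∁? P? i))
    ≡⟨ sum-cong-≗ {n} (λ i → trans (indicator-∁ (P? i)) (sym (indicator-yes (toℕ i <? n) (Finₚ.toℕ<n i)))) ⟩
  count {n} (λ i → toℕ i <? n)               ≡⟨ count-below {n} ≤-refl ⟩
  n                                          ∎
  where open ≡-Reasoning

count-permute : {P : Pred (Fin n) 0ℓ} (P? : Decidable P) (σ : Permutation′ n) →
                count (λ i → P? (σ ⟨$⟩ʳ i)) ≡ count P?
count-permute P? σ = sym (sum-permute (indicator ∘ P?) σ)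

∣∣≡count : (S : Subset n) → ∣ S ∣ ≡ count (_∈? S)
∣∣≡count []          = refl
∣∣≡count (true ∷ S)  = cong suc (trans (∣∣≡count S) (count-cong (_∈? S) _ there drop-there))
∣∣≡count (false ∷ S) = trans (∣∣≡count S) (count-cong (_∈? S) _ there drop-there)

least-witness : {P : Pred (Fin n) 0ℓ} → Decidable P → ∃ P →
                Σ (Fin n) λ i → P i × (∀ {j} → P j → toℕ i ≤ toℕ j)
least-witness P? (zero , P0) = zero , P0 , λ _ → z≤n
least-witness P? (suc x , Px) with P? zero
... | yes P0 = zero , P0 , λ _ → z≤n
... | no ¬P0 with least-witness (P? ∘ suc) (x , Px)
...   | i , Pi , least = suc i , Pi , λ { {zero} P0 → ⊥-elim (¬P0 P0) ; {suc j} Pj → s≤s (least Pj) }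

injective⇒surjective : (f : Fin n → Fin n) → Injective _≡_ _≡_ f → ∀ y → ∃ λ x → f x ≡ y
injective⇒surjective {zero}  f inj ()
injective⇒surjective {suc n} f inj y with Finₚ.any? (λ x → f x ≟ y)
... | yes hit = hit
... | no miss = ⊥-elim (<-irrefl refl (Finₚ.injective⇒≤ punchOut-inj))
  where
  avoids : ∀ x → y ≢ f x
  avoids x eq = miss (x , sym eq)
  punchOut-inj : Injective _≡_ _≡_ (λ x → Fin.punchOut (avoids x))
  punchOut-inj {a} {b} eq = inj (Finₚ.punchOut-injective (avoids a) (avoids b) eq)

injective⇒permutation : (f : Fin n → Fin n) → Injective _≡_ _≡_ f → Permutation′ n
injective⇒permutation f inj =
  mk↔ₛ′ f (proj₁ ∘ surj) (proj₂ ∘ surj) (λ x → inj (proj₂ (surj (f x))))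
  where
  surj : ∀ y → ∃ λ x → f x ≡ y
  surj = injective⇒surjective f inj

rank : {Q : Pred (Fin n) 0ℓ} → Decidable Q → Fin n → ℕ
rank Q? i = count ((λ x → toℕ x <? toℕ i) ∩? Q?)

module _ {Q : Pred (Fin n) 0ℓ} (Q? : Decidable Q) where

  rank-mono : ∀ {i j} → Q i → toℕ i < toℕ j → rank Q? i < rank Q? j
  rank-mono {i} {j} Qi i<j = count-strict-mono
    ((λ x → toℕ x <? toℕ i) ∩? Q?) ((λ x → toℕ x <? toℕ j) ∩? Q?)
    (λ (x<i , Qx) → <-trans x<i i<j , Qx)
    (λ (i<i , _) → <-irrefl refl i<i) (i<j , Qi)

  rank<count : ∀ {i} → Q i → rank Q? i < count Q?
  rank<count {i} Qi = count-strict-mono ((λ x → toℕ x <? toℕ i) ∩? Q?) Q?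
    proj₂ (λ (i<i , _) → <-irrefl refl i<i) Qi

module StablePartition {n} {D : Pred (Fin n) 0ℓ} (D? : Decidable D) where

  position : (i : Fin n) → Dec (D i) → ℕ
  position i (yes _) = rank D? i
  position i (no _)  = count D? + rank (∁? D?) i

  position<n : ∀ i (d : Dec (D i)) → position i d < n
  position<n i (yes Di) = begin-strict
    rank D? i                   <⟨ rank<count D? Di ⟩
    count D?                    ≤⟨ m≤m+n (count D?) (count (∁? D?)) ⟩
    count D? + count (∁? D?)    ≡⟨ count-∁ D? ⟩
    n                           ∎
    where open ≤-Reasoning
  position<n i (no ¬Di) = begin-strict
    count D? + rank (∁? D?) i   <⟨ +-monoʳ-< (count D?) (rank<count (∁? D?) ¬Di) ⟩
    count D? + count (∁? D?)    ≡⟨ count-∁ D? ⟩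
    n                           ∎
    where open ≤-Reasoning

  position<count⇔ : ∀ i (d : Dec (D i)) → (D i → position i d < count D?) × (position i d < count D? → D i)
  position<count⇔ i (yes Di)  = (λ _ → rank<count D? Di) , (λ _ → Di)
  position<count⇔ i (no ¬Di) = (λ Di → ⊥-elim (¬Di Di)) , (λ lt → ⊥-elim (<⇒≱ lt (m≤m+n _ _)))

  position-mono : ∀ {i j} → toℕ i < toℕ j → (D j → D i) →
                  (di : Dec (D i)) (dj : Dec (D j)) → position i di < position j dj
  position-mono i<j _    (yes Di)  (yes _)   = rank-mono D? Di i<j
  position-mono i<j _    (yes Di)  (no _)    = <-≤-trans (rank<count D? Di) (m≤m+n _ _)
  position-mono i<j _    (no ¬Di) (no _)    = +-monoʳ-< (count D?) (rank-mono (∁? D?) ¬Di i<j)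
  position-mono i<j down (no ¬Di) (yes Dj)  = ⊥-elim (¬Di (down Dj))

  place : Fin n → Fin n
  place i = fromℕ< (position<n i (D? i))

  toℕ-place : ∀ i → toℕ (place i) ≡ position i (D? i)
  toℕ-place i = Finₚ.toℕ-fromℕ< (position<n i (D? i))

  place<count⇔ : ∀ i → (D i → toℕ (place i) < count D?) × (toℕ (place i) < count D? → D i)
  place<count⇔ i rewrite toℕ-place i = position<count⇔ i (D? i)

  place-mono : ∀ {i j} → toℕ i < toℕ j → (D j → D i) → toℕ (place i) < toℕ (place j)
  place-mono {i} {j} i<j down rewrite toℕ-place i | toℕ-place j = position-mono i<j down (D? i) (D? j)

  same-place-preserves-D : ∀ i j → place i ≡ place j → D i → D j
  same-place-preserves-D i j eq Di =
    proj₂ (place<count⇔ j) (subst (λ x → toℕ x < count D?) eq (proj₁ (place<count⇔ i) Di))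

  place-injective : Injective _≡_ _≡_ place
  place-injective {i} {j} eq with <-cmp (toℕ i) (toℕ j)
  ... | tri< i<j _ _ = ⊥-elim (<⇒≢ (place-mono i<j (same-place-preserves-D j i (sym eq))) (cong toℕ eq))
  ... | tri≈ _ i≡j _ = Finₚ.toℕ-injective i≡j
  ... | tri> _ _ j<i = ⊥-elim (<⇒≢ (place-mono j<i (same-place-preserves-D i j eq)) (cong toℕ (sym eq)))

  stable-partition : Σ (Permutation′ n) λ σ →
    (∀ i → (D i → toℕ (σ ⟨$⟩ʳ i) < count D?) × (toℕ (σ ⟨$⟩ʳ i) < count D? → D i)) ×
    (∀ {i j} → toℕ i < toℕ j → (D j → D i) → toℕ (σ ⟨$⟩ʳ i) < toℕ (σ ⟨$⟩ʳ j))
  stable-partition = injective⇒permutation place place-injective , place<count⇔ , place-mono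

open StablePartition using (stable-partition)

nonempty-of-same-size : {S T : Subset n} {x : Fin n} → ∣ S ∣ ≡ ∣ T ∣ → x ∈ S → Nonempty T
nonempty-of-same-size {n} {S} {T} {x} ∣S∣≡∣T∣ x∈S with nonempty? T
... | yes T≠∅ = T≠∅
... | no  T=∅ = ⊥-elim (n≮0 (subst (∣ S - x ∣ <_) ∣S∣≡0 (x∈p⇒∣p-x∣<∣p∣ x∈S)))
  where
  ∣S∣≡0 : ∣ S ∣ ≡ 0
  ∣S∣≡0 = trans ∣S∣≡∣T∣ (trans (cong ∣_∣ (Empty-unique T=∅)) (∣⊥∣≡0 n))

module EncodedState (n p k : ℕ) (Sm Sp : Subset n)
  (Sm-above : ∀ l → l ∈ Sm → k < pos l) (Sp-below : ∀ h → h ∈ Sp → pos h ≤ k) where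

  Sm-disjoint-Sp : ∀ {i} → i ∈ Sm → i ∉ Sp
  Sm-disjoint-Sp {i} i∈Sm i∈Sp = <⇒≱ (Sm-above i i∈Sm) (Sp-below i i∈Sp)

  Sp-disjoint-Decoded : ∀ {i} → i ∈ Sp → ¬ Decoded k Sm Sp i
  Sp-disjoint-Decoded i∈Sp (inj₁ (_ , i∉Sp)) = i∉Sp i∈Sp
  Sp-disjoint-Decoded i∈Sp (inj₂ i∈Sm)       = Sm-disjoint-Sp i∈Sm i∈Sp

  Kept? : Decidable (λ i → pos i ≤ k × i ∉ Sp)
  Kept? = (λ i → pos i ≤? k) ∩? ∁? (_∈? Sp)

  Decoded? : Decidable (Decoded k Sm Sp)
  Decoded? = Kept? ∪? (_∈? Sm)

  count-Decoded : k ≤ n → count Decoded? + ∣ Sp ∣ ≡ k + ∣ Sm ∣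
  count-Decoded k≤n = begin
    count Decoded? + ∣ Sp ∣                        ≡⟨ cong₂ _+_ (count-∪ Kept? (_∈? Sm) Kept∩Sm=∅) (∣∣≡count Sp) ⟩
    count Kept? + count (_∈? Sm) + count (_∈? Sp)  ≡⟨ xy∙z≈xz∙y (count Kept?) _ _ ⟩
    count Kept? + count (_∈? Sp) + count (_∈? Sm)  ≡⟨ cong₂ _+_ first-k (∣∣≡count Sm) ⟨
    k + ∣ Sm ∣                                     ∎
    where
    open ≡-Reasoning
    Kept∩Sm=∅ : ∀ {i} → pos i ≤ k × i ∉ Sp → i ∉ Sm
    Kept∩Sm=∅ (i≤k , _) i∈Sm = <⇒≱ (Sm-above _ i∈Sm) i≤k
    join : ∀ {i} → (pos i ≤ k × i ∉ Sp) ⊎ i ∈ Sp → pos i ≤ k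
    join (inj₁ (i≤k , _)) = i≤k
    join (inj₂ i∈Sp)      = Sp-below _ i∈Sp
    split : ∀ {i} → pos i ≤ k → (pos i ≤ k × i ∉ Sp) ⊎ i ∈ Sp
    split {i} i≤k with i ∈? Sp
    ... | yes i∈Sp = inj₂ i∈Sp
    ... | no  i∉Sp = inj₁ (i≤k , i∉Sp)
    first-k : k ≡ count Kept? + count (_∈? Sp)
    first-k = begin
      k                                 ≡⟨ count-below {n} k≤n ⟨
      count {n} (λ i → pos i ≤? k)      ≡⟨ count-cong (λ i → pos i ≤? k) (Kept? ∪? (_∈? Sp)) split join ⟩
      count (Kept? ∪? (_∈? Sp))         ≡⟨ count-∪ Kept? (_∈? Sp) proj₂ ⟩
      count Kept? + count (_∈? Sp)      ∎

  module _ {Vr : Set} {w : Vr} where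

    valid⇒count-Decoded : ValidEncoded n p k Sm Sp w → k ≤ n → count Decoded? ≡ k
    valid⇒count-Decoded (σ , _ , first⇔) k≤n = begin
      count Decoded?
        ≡⟨ count-cong Decoded? (λ i → pos (σ ⟨$⟩ʳ i) ≤? k) (proj₁ (first⇔ _)) (proj₂ (first⇔ _)) ⟩
      count (λ i → pos (σ ⟨$⟩ʳ i) ≤? k)       ≡⟨ count-permute (λ i → pos i ≤? k) σ ⟩
      count {n} (λ i → pos i ≤? k)            ≡⟨ count-below k≤n ⟩
      k                                       ∎
      where open ≡-Reasoning

    valid⇒same-size : ValidEncoded n p k Sm Sp w → k ≤ n → ∣ Sm ∣ ≡ ∣ Sp ∣
    valid⇒same-size valid k≤n = +-cancelˡ-≡ k _ _ (begin
      k + ∣ Sm ∣                 ≡⟨ count-Decoded k≤n ⟨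
      count Decoded? + ∣ Sp ∣    ≡⟨ cong (_+ ∣ Sp ∣) (valid⇒count-Decoded valid k≤n) ⟩
      k + ∣ Sp ∣                 ∎)
      where open ≡-Reasoning

    valid⇒cond3 : ValidEncoded n p k Sm Sp w → Cond3 p Sm Sp
    valid⇒cond3 (_ , nbs , first⇔) l h l∈Sm h∈Sp with pos l <? pos h + p
    ... | yes l<h+p = l<h+p
    ... | no  l≮h+p = ⊥-elim (Sp-disjoint-Decoded h∈Sp (proj₂ (first⇔ h)
          (≤-trans (<⇒≤ (nbs h l (≮⇒≥ l≮h+p))) (proj₁ (first⇔ l) (inj₂ l∈Sm)))))

  module _ (same-size : ∣ Sm ∣ ≡ ∣ Sp ∣) (cond3 : Cond3 p Sm Sp) where

    cond2 : Cond2 p k Sm Sp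
    cond2 = Sm-bounds , Sp-bounds
      where
      Sm-bounds : ∀ l → l ∈ Sm → k < pos l × pos l ≤ k + p ∸ 1
      Sm-bounds l l∈Sm =
        let h , h∈Sp = nonempty-of-same-size same-size l∈Sm
        in Sm-above l l∈Sm , <⇒≤pred (<-≤-trans (cond3 l h l∈Sm h∈Sp) (+-monoˡ-≤ p (Sp-below h h∈Sp)))
      Sp-bounds : ∀ h → h ∈ Sp → k + 2 ≤ pos h + p × pos h ≤ k
      Sp-bounds h h∈Sp =
        let l , l∈Sm = nonempty-of-same-size (sym same-size) h∈Sp
        in subst (_≤ pos h + p) (+-comm 2 k) (<-≤-trans (s≤s (Sm-above l l∈Sm)) (cond3 l h l∈Sm h∈Sp))
           , Sp-below h h∈Sp

    module _ {h₀ : Fin n} (h₀∈Sp : h₀ ∈ Sp) (h₀-least : ∀ {h} → h ∈ Sp → toℕ h₀ ≤ toℕ h) where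

      packed-window : ∣ Sp ∣ + (∣ Sm ∣ + toℕ h₀) ≤ toℕ h₀ + p
      packed-window = begin
        ∣ Sp ∣ + (∣ Sm ∣ + c)
          ≡⟨ cong₂ _+_ (∣∣≡count Sp) (cong₂ _+_ (∣∣≡count Sm) (sym (count-below c≤n))) ⟩
        count (_∈? Sp) + (count (_∈? Sm) + count below-c)
          ≡⟨ cong (count (_∈? Sp) +_) (count-∪ (_∈? Sm) below-c Sm-above-c) ⟨
        count (_∈? Sp) + count ((_∈? Sm) ∪? below-c)
          ≡⟨ count-∪ (_∈? Sp) ((_∈? Sm) ∪? below-c) Sp-disjoint ⟨
        count ((_∈? Sp) ∪? ((_∈? Sm) ∪? below-c))
          ≤⟨ count-mono _ (λ i → toℕ i <? c + p) window ⟩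
        count {n} (λ i → toℕ i <? c + p)  ≡⟨ count-toℕ< n (c + p) ⟩
        (c + p) ⊓ n                        ≤⟨ m⊓n≤m (c + p) n ⟩
        c + p                              ∎
        where
        open ≤-Reasoning
        c : ℕ
        c = toℕ h₀
        c≤n : c ≤ n
        c≤n = <⇒≤ (Finₚ.toℕ<n h₀)
        below-c : Decidable (λ (i : Fin n) → toℕ i < c)
        below-c i = toℕ i <? c
        Sm-above-c : ∀ {i} → i ∈ Sm → ¬ toℕ i < c
        Sm-above-c {i} i∈Sm i<c = <⇒≱ (Sm-above i i∈Sm) (≤-trans (<⇒≤ (s≤s i<c)) (Sp-below h₀ h₀∈Sp))
        Sp-disjoint : ∀ {i} → i ∈ Sp → ¬ (i ∈ Sm ⊎ toℕ i < c)
        Sp-disjoint i∈Sp (inj₁ i∈Sm) = Sm-disjoint-Sp i∈Sm i∈Sp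
        Sp-disjoint i∈Sp (inj₂ i<c)  = <⇒≱ i<c (h₀-least i∈Sp)
        k<c+p : k < c + p
        k<c+p = s≤s⁻¹ (subst (_≤ pos h₀ + p) (+-comm k 2) (proj₁ (proj₂ cond2 h₀ h₀∈Sp)))
        window : ∀ {i} → i ∈ Sp ⊎ (i ∈ Sm ⊎ toℕ i < c) → toℕ i < c + p
        window {i} (inj₁ i∈Sp)        = ≤-trans (Sp-below i i∈Sp) (<⇒≤ k<c+p)
        window {i} (inj₂ (inj₁ i∈Sm)) = s≤s⁻¹ (cond3 i h₀ i∈Sm h₀∈Sp)
        window {i} (inj₂ (inj₂ i<c))  = <-≤-trans i<c (m≤m+n c p)

    size-bound : 2 * ∣ Sm ∣ ≤ p
    size-bound with nonempty? Sp
    ... | no Sp=∅ = subst (λ m → 2 * m ≤ p) (sym ∣Sm∣≡0) z≤n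
      where
      ∣Sm∣≡0 : ∣ Sm ∣ ≡ 0
      ∣Sm∣≡0 = trans same-size (trans (cong ∣_∣ (Empty-unique Sp=∅)) (∣⊥∣≡0 n))
    ... | yes Sp≠∅ with least-witness (_∈? Sp) Sp≠∅
    ...   | h₀ , h₀∈Sp , h₀-least = +-cancelʳ-≤ (toℕ h₀) (2 * ∣ Sm ∣) p (begin
      2 * ∣ Sm ∣ + toℕ h₀           ≡⟨ cong (λ x → ∣ Sm ∣ + x + toℕ h₀) (+-identityʳ ∣ Sm ∣) ⟩
      ∣ Sm ∣ + ∣ Sm ∣ + toℕ h₀      ≡⟨ +-assoc ∣ Sm ∣ ∣ Sm ∣ (toℕ h₀) ⟩
      ∣ Sm ∣ + (∣ Sm ∣ + toℕ h₀)    ≡⟨ cong (_+ (∣ Sm ∣ + toℕ h₀)) same-size ⟩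
      ∣ Sp ∣ + (∣ Sm ∣ + toℕ h₀)    ≤⟨ packed-window h₀∈Sp h₀-least ⟩
      toℕ h₀ + p                    ≡⟨ +-comm (toℕ h₀) p ⟩
      p + toℕ h₀                    ∎)
      where open ≤-Reasoning

  Decoded-downward : Cond2 p k Sm Sp → Cond3 p Sm Sp →
                     ∀ {i j} → pos i + p ≤ pos j → Decoded k Sm Sp j → Decoded k Sm Sp i
  Decoded-downward (Sm-bounds , Sp-bounds) cond3 {i} {j} i+p≤j Dj = inj₁ (i≤k Dj , i∉Sp Dj)
    where
    i≤k : Decoded k Sm Sp j → pos i ≤ k
    i≤k (inj₁ (j≤k , _)) = ≤-trans (m≤m+n (pos i) p) (≤-trans i+p≤j j≤k)
    i≤k (inj₂ j∈Sm)      = +-cancelʳ-≤ p (pos i) k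
      (≤-trans i+p≤j (≤-trans (proj₂ (Sm-bounds j j∈Sm)) (m∸n≤m (k + p) 1)))
    i∉Sp : Decoded k Sm Sp j → i ∉ Sp
    i∉Sp (inj₁ (j≤k , _)) i∈Sp =
      <⇒≱ (m<m+n k (s≤s z≤n)) (≤-trans (proj₁ (Sp-bounds i i∈Sp)) (≤-trans i+p≤j j≤k))
    i∉Sp (inj₂ j∈Sm) i∈Sp = <⇒≱ (cond3 j i j∈Sm i∈Sp) i+p≤j

  conditions⇒valid : {Vr : Set} {w : Vr} → 1 ≤ p → k ≤ n →
                     Cond1 p Sm Sp → Cond2 p k Sm Sp → Cond3 p Sm Sp → ValidEncoded n p k Sm Sp w
  conditions⇒valid p≥1 k≤n (same-size , _) c2 c3
    with σ , σ<count⇔ , σ-mono ← stable-partition Decoded? = σ , nbs , first⇔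
    where
    count≡k : count Decoded? ≡ k
    count≡k = +-cancelʳ-≡ ∣ Sp ∣ _ _ (trans (count-Decoded k≤n) (cong (k +_) same-size))
    nbs : InNBS n p σ
    nbs i j i+p≤j = s≤s (σ-mono (s≤s⁻¹ (<-≤-trans (m<m+n (pos i) p≥1) i+p≤j))
                                (Decoded-downward c2 c3 i+p≤j))
    first⇔ : ∀ i → (Decoded k Sm Sp i → InFirst σ k i) × (InFirst σ k i → Decoded k Sm Sp i)
    first⇔ i = subst (λ c → (Decoded k Sm Sp i → toℕ (σ ⟨$⟩ʳ i) < c) ×
                            (toℕ (σ ⟨$⟩ʳ i) < c → Decoded k Sm Sp i))
                     count≡k (σ<count⇔ i)

proposition2 : (n p k : ℕ) → 1 ≤ p → 1 ≤ k → k ≤ n →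
    (Vr : Set) → (w : Vr) → (Sm Sp : Subset n) →
    (∀ (l : Fin n) → l ∈ Sm → k < pos l) →
    (∀ (h : Fin n) → h ∈ Sp → pos h ≤ k) →
    ValidEncoded n p k Sm Sp w ⇔ (Cond1 p Sm Sp × Cond2 p k Sm Sp × Cond3 p Sm Sp)
proposition2 n p k p≥1 _ k≤n Vr w Sm Sp Sm-above Sp-below = mk⇔ necessary sufficient
  where
  open EncodedState n p k Sm Sp Sm-above Sp-below
  necessary : ValidEncoded n p k Sm Sp w → Cond1 p Sm Sp × Cond2 p k Sm Sp × Cond3 p Sm Sp
  necessary valid = (same-size , size-bound same-size c3) , cond2 same-size c3 , c3
    where
    same-size : ∣ Sm ∣ ≡ ∣ Sp ∣
    same-size = valid⇒same-size {w = w} valid k≤n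
    c3 : Cond3 p Sm Sp
    c3 = valid⇒cond3 {w = w} valid
  sufficient : Cond1 p Sm Sp × Cond2 p k Sm Sp × Cond3 p Sm Sp → ValidEncoded n p k Sm Sp w
  sufficient (c1 , c2 , c3) = conditions⇒valid {w = w} p≥1 k≤n c1 c2 c3
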